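{- Let $t\ge 1$ be an integer. Define matrices $P'_n$ by $P'_1=J_{2,1}\otimes K_2\otimes J_{t,2t}$ and, for $n\ge 2$, $P'_n=J_{2^n,1}\otimes K_2\otimes \alpha_{2^{n-1}}(P'_{n-1})\otimes J_{1,2}$. Then $P'_n=P_n$ for all $n\ge 1$, where $P_n=J_{2^n,1}\otimes K_{2^n}\otimes J_{t,t\cdot 2^n}$.
   Context: $J_{m,l}$ is the all-ones $m\times l$ matrix; $K_m$ is the $m\times m$ exchange matrix with $K_m(i,j)=1$ if $i+j=m+1$ and $0$ otherwise; $\otimes$ denotes the Kronecker product. For an $m\times l$ matrix $X$ and $s$ dividing $m$, $\alpha_s(X)$ denotes the matrix formed by the first $m/s$ rows of $X$. -}

module Defs where

open import Data.Nat using (ℕ; zero; suc; _+_; _*_; _^_; NonZero)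
open import Data.Nat.DivMod using (_/_; m/n≤m)
open import Data.Nat.Properties using (_≟_; m^n≢0)
open import Data.Fin using (Fin; toℕ; cast; inject≤; remQuot)
open import Data.Product using (proj₁; proj₂)
open import Data.Bool using (if_then_else_)
open import Relation.Nullary.Decidable using (⌊_⌋)
open import Relation.Binary.PropositionalEquality using (_≡_)

record Mat : Set where
  constructor mat
  field
    rows  : ℕ
    cols  : ℕ
    entry : Fin rows → Fin cols → ℕ
open Mat public

record _≋_ (A B : Mat) : Set where
  field
    rowsEq    : rows A ≡ rows B
    colsEq    : cols A ≡ cols B
    entriesEq : ∀ i j → entry A i j ≡ entry B (cast rowsEq i) (cast colsEq j)

J : ℕ → ℕ → Mat
J m l = mat m l (λ _ _ → 1)

-- exchange matrix: K(i,j) = 1 iff i + j = m + 1 (1-indexed)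
K : ℕ → Mat
K m = mat m m (λ i j → if ⌊ suc (toℕ i) + suc (toℕ j) ≟ suc m ⌋ then 1 else 0)

-- Kronecker product: (A ⊗ B)((a,b),(c,d)) = A(a,c) * B(b,d), row index a*p+b
_⊗_ : Mat → Mat → Mat
A ⊗ B = mat (rows A * rows B) (cols A * cols B)
  (λ i j → entry A (proj₁ (remQuot {rows A} (rows B) i)) (proj₁ (remQuot {cols A} (cols B) j))
         * entry B (proj₂ (remQuot {rows A} (rows B) i)) (proj₂ (remQuot {cols A} (cols B) j)))
infixl 7 _⊗_

α : (s : ℕ) → .{{_ : NonZero s}} → Mat → Mat
α s X = mat (rows X / s) (cols X) (λ i j → entry X (inject≤ i (m/n≤m (rows X) s)) j)

P : ℕ → ℕ → Mat
P t n = J (2 ^ n) 1 ⊗ K (2 ^ n) ⊗ J t (t * 2 ^ n)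

-- P'_n (n ≥ 1); P' t 0 is an unused junk value
P′ : ℕ → ℕ → Mat
P′ t zero = J 0 0
P′ t (suc zero) = J 2 1 ⊗ K 2 ⊗ J t (2 * t)
P′ t (suc (suc k)) =
  J (2 ^ suc (suc k)) 1 ⊗ K 2 ⊗ α (2 ^ suc k) {{m^n≢0 2 (suc k)}} (P′ t (suc k)) ⊗ J 1 2

module Submission where

-- Every matrix involved is described entrywise, with the Kronecker product acting on
-- indices by division and remainder. The first 2^(n-1) t rows of P_{n-1} form the block
-- row K_{2^(n-1)} ⊗ J_{t, t 2^(n-1)}, so by induction α(P'_{n-1}) is that block row.
-- Substituting it, P'_n = J ⊗ K_2 ⊗ K_{2^(n-1)} ⊗ J_{t, t 2^(n-1)} ⊗ J_{1,2}, and the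
-- whole argument reduces to K_{2N} = K_2 ⊗ K_N, checked on the four N × N blocks.

open import Defs
open import Data.Nat using (ℕ; _≤_)
open import Data.Nat.Base using (zero; suc; _+_; _*_; _^_; _<_; NonZero; s≤s; >-nonZero)
open import Data.Nat.Properties
open import Data.Nat.DivMod
open import Data.Nat.Divisibility using (divides)
open import Data.Nat.Tactic.RingSolver using (solve-∀)
open import Data.Fin using (Fin; toℕ; quotient; remainder)
open import Data.Fin.Properties using (toℕ<n; toℕ-combine; combine-remQuot; toℕ-cast; toℕ-inject≤)
open import Data.Bool using (if_then_else_)
open import Function.Bundles using (_⇔_; mk⇔; Equivalence)
open import Relation.Nullary using (yes; no; ¬_)
open import Relation.Nullary.Decidable using (⌊_⌋)
open import Relation.Binary.PropositionalEquality hiding (J)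
open import Data.Empty using (⊥-elim)

[n*q+r]/n≡q : ∀ q r n .{{_ : NonZero n}} → r < n → (n * q + r) / n ≡ q
[n*q+r]/n≡q q r n r<n = begin
  (n * q + r) / n   ≡⟨ /-congˡ (trans (+-comm (n * q) r) (cong (r +_) (*-comm n q))) ⟩
  (r + q * n) / n   ≡⟨ +-distrib-/ r (q * n) remainders<n ⟩
  r / n + q * n / n ≡⟨ cong₂ _+_ (m<n⇒m/n≡0 r<n) (m*n/n≡m q n) ⟩
  q                 ∎
  where
  open ≡-Reasoning
  remainders<n : r % n + q * n % n < n
  remainders<n = subst (_< n) (sym (trans (cong₂ _+_ (m<n⇒m%n≡m r<n) (m*n%n≡0 q n)) (+-identityʳ r)))
                       r<n

[n*q+r]%n≡r : ∀ q r n .{{_ : NonZero n}} → r < n → (n * q + r) % n ≡ r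
[n*q+r]%n≡r q r n r<n = begin
  (n * q + r) % n ≡⟨ %-congˡ (trans (+-comm (n * q) r) (cong (r +_) (*-comm n q))) ⟩
  (r + q * n) % n ≡⟨ [m+kn]%n≡m%n r q n ⟩
  r % n           ≡⟨ m<n⇒m%n≡m r<n ⟩
  r               ∎
  where open ≡-Reasoning

m%[n*o]/o%n≡m/o%n : ∀ m n o .{{_ : NonZero n}} .{{_ : NonZero o}} {{_ : NonZero (n * o)}} →
                    m % (n * o) / o % n ≡ m / o % n
m%[n*o]/o%n≡m/o%n m n o = trans (cong (_% n) (m%[n*o]/o≡m/o%n m n o)) (m%n%n≡m%n (m / o) n)

m%[o*n]≡n*[m/n%o]+m%n : ∀ m n o .{{_ : NonZero n}} .{{_ : NonZero o}} {{_ : NonZero (o * n)}} →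
                        m % (o * n) ≡ n * (m / n % o) + m % n
m%[o*n]≡n*[m/n%o]+m%n m n o = begin
  m % (o * n)                          ≡⟨ m≡m%n+[m/n]*n (m % (o * n)) n ⟩
  m % (o * n) % n + m % (o * n) / n * n ≡⟨ cong₂ (λ a b → a + b * n)
                                              (m∣n⇒o%n%m≡o%m n (o * n) m (divides o refl))
                                              (m%[n*o]/o≡m/o%n m o n) ⟩
  m % n + m / n % o * n                ≡⟨ trans (+-comm (m % n) _)
                                              (cong (_+ m % n) (*-comm (m / n % o) n)) ⟩
  n * (m / n % o) + m % n              ∎
  where open ≡-Reasoning

toℕ-remQuot : ∀ {m} k (i : Fin (m * k)) →
              toℕ i ≡ k * toℕ (quotient {m} k i) + toℕ (remainder {m} k i)
toℕ-remQuot {m} k i =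
  trans (cong toℕ (sym (combine-remQuot {m} k i))) (toℕ-combine (quotient {m} k i) (remainder {m} k i))

toℕ-quotient : ∀ {m} k .{{_ : NonZero k}} (i : Fin (m * k)) → toℕ (quotient {m} k i) ≡ toℕ i / k
toℕ-quotient {m} k i =
  sym (trans (/-congˡ (toℕ-remQuot {m} k i)) ([n*q+r]/n≡q _ _ k (toℕ<n (remainder {m} k i))))

toℕ-remainder : ∀ {m} k .{{_ : NonZero k}} (i : Fin (m * k)) → toℕ (remainder {m} k i) ≡ toℕ i % k
toℕ-remainder {m} k i =
  sym (trans (%-congˡ (toℕ-remQuot {m} k i)) ([n*q+r]%n≡r _ _ k (toℕ<n (remainder {m} k i))))

-- A record rather than a function type, so that f is recovered by unification.
record HasEntries (A : Mat) (f : ℕ → ℕ → ℕ) : Set where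
  constructor hasEntries
  field entry≡ : ∀ i j → entry A i j ≡ f (toℕ i) (toℕ j)
open HasEntries

HasEntries-ext : ∀ {A f} g → HasEntries A f → (∀ x y → f x y ≡ g x y) → HasEntries A g
HasEntries-ext g hasF f≗g = hasEntries λ i j → trans (entry≡ hasF i j) (f≗g _ _)

HasEntries-J : ∀ m l → HasEntries (J m l) (λ _ _ → 1)
HasEntries-J m l = hasEntries λ _ _ → refl

HasEntries-⊗ : ∀ {A B f g} .{{_ : NonZero (rows B)}} .{{_ : NonZero (cols B)}} →
               HasEntries A f → HasEntries B g →
               HasEntries (A ⊗ B) (λ x y → f (x / rows B) (y / cols B) * g (x % rows B) (y % cols B))
HasEntries-⊗ {A} {B} {f} {g} hasF hasG = hasEntries λ i j →
  let qi = quotient {rows A} (rows B) i ; ri = remainder {rows A} (rows B) i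
      qj = quotient {cols A} (cols B) j ; rj = remainder {cols A} (cols B) j
  in begin
  entry (A ⊗ B) i j
    ≡⟨ cong₂ _*_ (entry≡ hasF qi qj) (entry≡ hasG ri rj) ⟩
  f (toℕ qi) (toℕ qj) * g (toℕ ri) (toℕ rj)
    ≡⟨ cong₂ _*_ (cong₂ f (toℕ-quotient {rows A} (rows B) i) (toℕ-quotient {cols A} (cols B) j))
                 (cong₂ g (toℕ-remainder {rows A} (rows B) i) (toℕ-remainder {cols A} (cols B) j)) ⟩
  f (toℕ i / rows B) (toℕ j / cols B) * g (toℕ i % rows B) (toℕ j % cols B) ∎
  where open ≡-Reasoning

HasEntries-J⊗ : ∀ m l {B g} .{{_ : NonZero (rows B)}} .{{_ : NonZero (cols B)}} → HasEntries B g →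
                HasEntries (J m l ⊗ B) (λ x y → g (x % rows B) (y % cols B))
HasEntries-J⊗ m l hasG =
  HasEntries-ext _ (HasEntries-⊗ (HasEntries-J m l) hasG) (λ _ _ → *-identityˡ _)

HasEntries-⊗J : ∀ {A f} m l .{{_ : NonZero m}} .{{_ : NonZero l}} → HasEntries A f →
                HasEntries (A ⊗ J m l) (λ x y → f (x / m) (y / l))
HasEntries-⊗J m l hasF =
  HasEntries-ext _ (HasEntries-⊗ hasF (HasEntries-J m l)) (λ _ _ → *-identityʳ _)

HasEntries-α : ∀ s .{{_ : NonZero s}} {X f} → HasEntries X f → HasEntries (α s X) f
HasEntries-α s {f = f} hasF = hasEntries λ i j →
  trans (entry≡ hasF _ j) (cong (λ x → f x (toℕ j)) (toℕ-inject≤ i _))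

HasEntries⇒≋ : ∀ {A B f} (rows≡ : rows A ≡ rows B) (cols≡ : cols A ≡ cols B) →
               HasEntries A f → HasEntries B f → A ≋ B
HasEntries⇒≋ {f = f} rows≡ cols≡ hasA hasB = record
  { rowsEq    = rows≡
  ; colsEq    = cols≡
  ; entriesEq = λ i j → trans (entry≡ hasA i j)
      (sym (trans (entry≡ hasB _ _) (cong₂ f (toℕ-cast rows≡ i) (toℕ-cast cols≡ j))))
  }

exchange : ℕ → ℕ → ℕ → ℕ
exchange m x y = if ⌊ suc x + suc y ≟ suc m ⌋ then 1 else 0

HasEntries-K : ∀ m → HasEntries (K m) (exchange m)
HasEntries-K m = hasEntries λ _ _ → refl

exchange-≡0 : ∀ {m x y} → ¬ (suc x + suc y ≡ suc m) → exchange m x y ≡ 0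
exchange-≡0 {m} {x} {y} ≢m with suc x + suc y ≟ suc m
... | yes ≡m = ⊥-elim (≢m ≡m)
... | no _   = refl

exchange-cong : ∀ {m x y m′ x′ y′} → (suc x + suc y ≡ suc m ⇔ suc x′ + suc y′ ≡ suc m′) →
                exchange m x y ≡ exchange m′ x′ y′
exchange-cong {m} {x} {y} {m′} {x′} {y′} criteria⇔
  with suc x + suc y ≟ suc m | suc x′ + suc y′ ≟ suc m′
... | yes _  | yes _   = refl
... | no _   | no _    = refl
... | yes ≡m | no ≢m′  = ⊥-elim (≢m′ (Equivalence.to criteria⇔ ≡m))
... | no ≢m  | yes ≡m′ = ⊥-elim (≢m (Equivalence.from criteria⇔ ≡m′))

offset-⇔ : ∀ M {s s′} → s ≡ M + s′ → (s ≡ suc (2 * M) ⇔ s′ ≡ suc M)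
offset-⇔ M {s} {s′} s≡M+s′ = mk⇔
  (λ s≡2M+1 → +-cancelˡ-≡ M _ _ (trans (sym s≡M+s′) (trans s≡2M+1 (2M+1≡M+[M+1] M))))
  (λ s′≡M+1 → trans s≡M+s′ (trans (cong (M +_) s′≡M+1) (sym (2M+1≡M+[M+1] M))))
  where
  2M+1≡M+[M+1] : ∀ M → suc (2 * M) ≡ M + suc M
  2M+1≡M+[M+1] = solve-∀

-- K_{2M} = K_2 ⊗ K_M, read off entrywise on the four M × M blocks.
exchange-double : ∀ M {a b r w} → a < 2 → b < 2 → r < M → w < M →
                  exchange (2 * M) (M * a + r) (M * b + w) ≡ exchange 2 a b * exchange M r w
exchange-double M {0} {0} {r} {w} _ _ r<M w<M rewrite *-zeroʳ M =
  exchange-≡0 (<⇒≢ (s≤s (≤-trans (+-mono-≤ r<M w<M) (≤-reflexive (M+M≡2*M M)))))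
  where
  M+M≡2*M : ∀ M → M + M ≡ 2 * M
  M+M≡2*M = solve-∀
exchange-double M {1} {0} {r} {w} _ _ _ _ rewrite *-zeroʳ M | *-identityʳ M =
  trans (exchange-cong (offset-⇔ M (shift M r w))) (sym (+-identityʳ _))
  where
  shift : ∀ M r w → suc (M + r) + suc w ≡ M + (suc r + suc w)
  shift = solve-∀
exchange-double M {0} {1} {r} {w} _ _ _ _ rewrite *-zeroʳ M | *-identityʳ M =
  trans (exchange-cong (offset-⇔ M (shift M r w))) (sym (+-identityʳ _))
  where
  shift : ∀ M r w → suc r + suc (M + w) ≡ M + (suc r + suc w)
  shift = solve-∀
exchange-double M {1} {1} {r} {w} _ _ _ _ rewrite *-identityʳ M =
  exchange-≡0 (λ ≡2M+1 → m+1+n≢m (suc (2 * M)) (trans (sym (shift M r w)) ≡2M+1))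
  where
  shift : ∀ M r w → suc (M + r) + suc (M + w) ≡ suc (2 * M) + suc (r + w)
  shift = solve-∀
exchange-double M {suc (suc _)} (s≤s (s≤s ())) _ _ _
exchange-double M {_} {suc (suc _)} _ (s≤s (s≤s ())) _ _

exchange-mod-double : ∀ M .{{_ : NonZero M}} {{_ : NonZero (2 * M)}} q p →
                      exchange (2 * M) (q % (2 * M)) (p % (2 * M))
                        ≡ exchange 2 (q / M % 2) (p / M % 2) * exchange M (q % M) (p % M)
exchange-mod-double M q p = begin
  exchange (2 * M) (q % (2 * M)) (p % (2 * M))
    ≡⟨ cong₂ (exchange (2 * M)) (m%[o*n]≡n*[m/n%o]+m%n q M 2) (m%[o*n]≡n*[m/n%o]+m%n p M 2) ⟩
  exchange (2 * M) (M * (q / M % 2) + q % M) (M * (p / M % 2) + p % M)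
    ≡⟨ exchange-double M (m%n<n (q / M) 2) (m%n<n (p / M) 2) (m%n<n q M) (m%n<n p M) ⟩
  exchange 2 (q / M % 2) (p / M % 2) * exchange M (q % M) (p % M) ∎
  where open ≡-Reasoning

P-entry : (N t : ℕ) .{{_ : NonZero N}} .{{_ : NonZero t}} → ℕ → ℕ → ℕ
P-entry N t x y = exchange N (x / t % N) (y / (t * N) % N)
  where instance _ = m*n≢0 t N

HasEntries-P : ∀ t n .{{_ : NonZero t}} → HasEntries (P t n) (P-entry (2 ^ n) t {{m^n≢0 2 n}})
HasEntries-P t n =
  HasEntries-⊗J t (t * N) (HasEntries-J⊗ N 1 (HasEntries-K N))
  where
  N = 2 ^ n
  instance
    _ = m^n≢0 2 n
    _ = m*n≢0 t N

P-entry-double : ∀ M t R C .{{_ : NonZero M}} .{{_ : NonZero t}}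
                   .{{_ : NonZero R}} .{{_ : NonZero C}} →
                 R ≡ M * t → C ≡ M * (t * M) → ∀ x y →
                 exchange 2 (x / 1 / R % 2) (y / 2 / C % 2) * P-entry M t (x / 1 % R) (y / 2 % C)
                   ≡ P-entry (2 * M) t {{m*n≢0 2 M}} x y
P-entry-double M t _ _ refl refl x y = begin
  exchange 2 (x / 1 / (M * t) % 2) (y / 2 / (M * (t * M)) % 2)
    * exchange M (x / 1 % (M * t) / t % M) (y / 2 % (M * (t * M)) / (t * M) % M)
    ≡⟨ cong₂ _*_ (cong₂ (exchange 2) (cong (_% 2) row-quotient) (cong (_% 2) column-quotient))
                 (cong₂ (exchange M) row-remainder column-remainder) ⟩
  exchange 2 (q / M % 2) (p / M % 2) * exchange M (q % M) (p % M)
    ≡⟨ exchange-mod-double M q p ⟨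
  exchange (2 * M) (q % (2 * M)) (p % (2 * M)) ∎
  where
  open ≡-Reasoning
  instance
    _ = m*n≢0 2 M
    _ = m*n≢0 t M
    _ = m*n≢0 t (2 * M)
    _ = m*n≢0 2 (t * M)
    _ = m*n≢0 2 (M * (t * M))
    _ = m*n≢0 (t * (2 * M)) M
  q = x / t
  p = y / (t * (2 * M))
  2[tM]≡t[2M] : ∀ M t → 2 * (t * M) ≡ t * (2 * M)
  2[tM]≡t[2M] = solve-∀
  2[M[tM]]≡t[2M]M : ∀ M t → 2 * (M * (t * M)) ≡ t * (2 * M) * M
  2[M[tM]]≡t[2M]M = solve-∀
  row-quotient : x / 1 / (M * t) ≡ q / M
  row-quotient =
    trans (/-congˡ (n/1≡n x)) (trans (/-congʳ (*-comm M t)) (sym (m/n/o≡m/[n*o] x t M)))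
  row-remainder : x / 1 % (M * t) / t % M ≡ q % M
  row-remainder = trans (cong (λ z → z % (M * t) / t % M) (n/1≡n x))
                        (m%[n*o]/o%n≡m/o%n x M t {{_}} {{_}} {{m*n≢0 M t}})
  column-quotient : y / 2 / (M * (t * M)) ≡ p / M
  column-quotient = begin
    y / 2 / (M * (t * M))     ≡⟨ m/n/o≡m/[n*o] y 2 (M * (t * M)) ⟩
    y / (2 * (M * (t * M)))   ≡⟨ /-congʳ (2[M[tM]]≡t[2M]M M t) ⟩
    y / (t * (2 * M) * M)     ≡⟨ m/n/o≡m/[n*o] y (t * (2 * M)) M ⟨
    p / M                     ∎
  column-remainder : y / 2 % (M * (t * M)) / (t * M) % M ≡ p % M
  column-remainder = begin
    y / 2 % (M * (t * M)) / (t * M) % M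
      ≡⟨ m%[n*o]/o%n≡m/o%n (y / 2) M (t * M) {{_}} {{_}} {{m*n≢0 M (t * M)}} ⟩
    y / 2 / (t * M) % M                 ≡⟨ cong (_% M) (m/n/o≡m/[n*o] y 2 (t * M)) ⟩
    y / (2 * (t * M)) % M               ≡⟨ cong (_% M) (/-congʳ (2[tM]≡t[2M] M t)) ⟩
    p % M                               ∎

rows-P′ : ∀ t k → rows (P′ t (suc k)) ≡ rows (P t (suc k))
rows-α-P′ : ∀ t k → rows (α (2 ^ suc k) {{m^n≢0 2 (suc k)}} (P′ t (suc k))) ≡ 2 ^ suc k * t

rows-P′ t zero    = refl
rows-P′ t (suc k) = trans (cong (λ R → 2 * M * 2 * R * 1) (rows-α-P′ t k)) (rearrange M t)
  where
  M = 2 ^ suc k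
  rearrange : ∀ M t → 2 * M * 2 * (M * t) * 1 ≡ 2 * M * (2 * M) * t
  rearrange = solve-∀

rows-α-P′ t k =
  trans (/-congˡ (trans (rows-P′ t k) (trans (*-assoc M M t) (*-comm M (M * t))))) (m*n/n≡m (M * t) M)
  where
  M = 2 ^ suc k
  instance _ = m^n≢0 2 (suc k)

cols-P′ : ∀ t k → cols (P′ t (suc k)) ≡ cols (P t (suc k))
cols-P′ t zero    = cong (1 * 2 *_) (*-comm 2 t)
cols-P′ t (suc k) = trans (cong (λ C → 1 * 2 * C * 2) (cols-P′ t k)) (rearrange (2 ^ suc k) t)
  where
  rearrange : ∀ M t → 1 * 2 * (1 * M * (t * M)) * 2 ≡ 1 * (2 * M) * (t * (2 * M))
  rearrange = solve-∀

HasEntries-P′ : ∀ t k .{{_ : NonZero t}} →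
                HasEntries (P′ t (suc k)) (P-entry (2 ^ suc k) t {{m^n≢0 2 (suc k)}})
HasEntries-P′ t zero =
  HasEntries-ext (P-entry 2 t)
    (HasEntries-⊗J t (2 * t) (HasEntries-J⊗ 2 1 (HasEntries-K 2)))
    (λ x y → cong (λ z → exchange 2 (x / t % 2) (z % 2)) (/-congʳ {m = y} (*-comm 2 t)))
  where
  instance
    _ = m*n≢0 2 t
    _ = m*n≢0 t 2
HasEntries-P′ t (suc k) =
  HasEntries-ext (P-entry (2 * M) t {{m*n≢0 2 M}}) (HasEntries-⊗J 1 2 blocks)
    (P-entry-double M t R C (rows-α-P′ t k) C≡M[tM])
  where
  M : ℕ
  M = 2 ^ suc k
  instance
    M≢0 : NonZero M
    M≢0 = m^n≢0 2 (suc k)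
  A : Mat
  A = P′ t (suc k)
  R C : ℕ
  R = rows (α M A)
  C = cols A
  C≡M[tM] : C ≡ M * (t * M)
  C≡M[tM] = trans (cols-P′ t k) (cong (_* (t * M)) (*-identityˡ M))
  instance
    _ : NonZero R
    _ = subst NonZero (sym (rows-α-P′ t k)) (m*n≢0 M t)
    _ : NonZero C
    _ = subst NonZero (sym C≡M[tM]) (m*n≢0 M (t * M) {{M≢0}} {{m*n≢0 t M}})
  blocks : HasEntries (J (2 * M) 1 ⊗ K 2 ⊗ α M A)
                      (λ x y → exchange 2 (x / R % 2) (y / C % 2) * P-entry M t (x % R) (y % C))
  blocks = HasEntries-⊗ (HasEntries-J⊗ (2 * M) 1 (HasEntries-K 2))
                        (HasEntries-α M (HasEntries-P′ t k))

lemma2 : (t : ℕ) → 1 ≤ t → (n : ℕ) → 1 ≤ n → P′ t n ≋ P t n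
lemma2 t 1≤t (suc k) _ =
  HasEntries⇒≋ (rows-P′ t k) (cols-P′ t k) (HasEntries-P′ t k) (HasEntries-P t (suc k))
  where instance _ = >-nonZero 1≤t
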